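{- For every integer $n\ge2$, the independent domination polynomial of the book graph $B_n$ is \[D_i(B_n,x)=(2^n-2)x^n+2x^{n+1}.\]
   Context: A set $S$ of vertices of a graph is an independent dominating set if no two vertices of $S$ are adjacent and every vertex outside $S$ has a neighbour in $S$; $d_i(G,k)$ is the number of such sets of size $k$ and $D_i(G,x)=\sum_k d_i(G,k)x^k$. The book graph $B_n$ has vertex set $\{u_1,u_2\}\cup\{v_i,w_i:1\le i\le n\}$ and edge set $\{u_1u_2\}\cup\{u_1v_i,\;u_2w_i,\;v_iw_i:1\le i\le n\}$. -}

module Defs where

open import Data.Nat using (ℕ; zero; suc; _+_; _*_; _∸_; _^_)
open import Data.Fin using (Fin; zero; suc; splitAt)
open import Data.Fin.Properties using (all?; any?)
open import Data.Bool using (Bool; true; false; T)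
open import Data.Bool.Properties using (T?)
open import Data.Vec using (Vec; []; _∷_; lookup)
open import Data.List using (List; []; _∷_; map; _++_; length; filter)
open import Data.Sum using (_⊎_; inj₁; inj₂)
open import Data.Product using (_×_; Σ; ∃; _,_)
open import Relation.Binary.PropositionalEquality using (_≡_; refl)
open import Relation.Nullary using (¬_; Dec; yes; no)
open import Relation.Nullary.Decidable using (_×-dec_; ¬?; _→-dec_)
import Data.Nat
import Data.Empty
import Relation.Binary.PropositionalEquality

record Graph : Set where
  field
    order  : ℕ
    adj    : Fin order → Fin order → Bool
    sym    : ∀ x y → adj x y ≡ adj y x
    irrefl : ∀ x → adj x x ≡ false
open Graph public

_~_within_ : ∀ {m} → Fin m → Fin m → (Fin m → Fin m → Bool) → Set
x ~ y within a = T (a x y)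

VSet : ℕ → Set
VSet m = Vec Bool m

_∈S_ : ∀ {m} → Fin m → VSet m → Set
x ∈S S = T (lookup S x)

card : ∀ {m} → VSet m → ℕ
card []          = 0
card (true ∷ S)  = suc (card S)
card (false ∷ S) = card S

Independent : (G : Graph) → VSet (order G) → Set
Independent G S = ∀ x y → x ∈S S → y ∈S S → ¬ T (adj G x y)

Dominating : (G : Graph) → VSet (order G) → Set
Dominating G S = ∀ x → ¬ (x ∈S S) → ∃ λ y → (y ∈S S) × T (adj G x y)

IndependentDominating : (G : Graph) → VSet (order G) → Set
IndependentDominating G S = Independent G S × Dominating G S

independent? : (G : Graph) (S : VSet (order G)) → Dec (Independent G S)
independent? G S =
  all? λ x → all? λ y → T? (lookup S x) →-dec (T? (lookup S y) →-dec ¬? (T? (adj G x y)))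

dominating? : (G : Graph) (S : VSet (order G)) → Dec (Dominating G S)
dominating? G S =
  all? λ x → ¬? (T? (lookup S x)) →-dec any? λ y → T? (lookup S y) ×-dec T? (adj G x y)

indDom? : (G : Graph) (S : VSet (order G)) → Dec (IndependentDominating G S)
indDom? G S = independent? G S ×-dec dominating? G S

allVSets : (m : ℕ) → List (VSet m)
allVSets zero    = [] ∷ []
allVSets (suc m) = map (true ∷_) (allVSets m) ++ map (false ∷_) (allVSets m)

hasSize? : ∀ {m} (k : ℕ) (S : VSet m) → Dec (card S ≡ k)
hasSize? k S = Data.Nat._≟_ (card S) k

-- d_i(G,k): number of independent dominating sets of G of size k.
-- D_i(G,x) = Σ_k d_i(G,k) x^k is determined by these coefficients.
dᵢ : Graph → ℕ → ℕ
dᵢ G k = length (filter (λ S → indDom? G S ×-dec hasSize? k S) (allVSets (order G)))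

data BookV (n : ℕ) : Set where
  u₁ u₂ : BookV n
  v w   : Fin n → BookV n

-- Vertex numbering on Fin (2 + (n + n)):
--   0 ↦ u₁, 1 ↦ u₂, 2 + i ↦ v_i, 2 + n + i ↦ w_i.
decode : ∀ {n} → Fin (2 + (n + n)) → BookV n
decode zero          = u₁
decode (suc zero)    = u₂
decode {n} (suc (suc j)) with splitAt n j
... | inj₁ i = v i
... | inj₂ i = w i

open import Data.Fin using (_≟_)
open import Relation.Nullary.Decidable using (⌊_⌋)

bookAdjV : ∀ {n} → BookV n → BookV n → Bool
bookAdjV u₁    u₂    = true
bookAdjV u₂    u₁    = true
bookAdjV u₁    (v _) = true
bookAdjV (v _) u₁    = true
bookAdjV u₂    (w _) = true
bookAdjV (w _) u₂    = true
bookAdjV (v i) (w j) = ⌊ i ≟ j ⌋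
bookAdjV (w i) (v j) = ⌊ i ≟ j ⌋
bookAdjV _     _     = false

bookAdjV-sym : ∀ {n} (a b : BookV n) → bookAdjV a b ≡ bookAdjV b a
bookAdjV-sym u₁ u₁ = refl
bookAdjV-sym u₁ u₂ = refl
bookAdjV-sym u₁ (v _) = refl
bookAdjV-sym u₁ (w _) = refl
bookAdjV-sym u₂ u₁ = refl
bookAdjV-sym u₂ u₂ = refl
bookAdjV-sym u₂ (v _) = refl
bookAdjV-sym u₂ (w _) = refl
bookAdjV-sym (v _) u₁ = refl
bookAdjV-sym (v _) u₂ = refl
bookAdjV-sym (v _) (v _) = refl
bookAdjV-sym (v i) (w j) with i ≟ j | j ≟ i
... | yes _ | yes _ = refl
... | no _  | no _  = refl
... | yes p | no q  = Data.Empty.⊥-elim (q (Relation.Binary.PropositionalEquality.sym p))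
... | no p  | yes q = Data.Empty.⊥-elim (p (Relation.Binary.PropositionalEquality.sym q))
bookAdjV-sym (w _) u₁ = refl
bookAdjV-sym (w _) u₂ = refl
bookAdjV-sym (w i) (v j) with i ≟ j | j ≟ i
... | yes _ | yes _ = refl
... | no _  | no _  = refl
... | yes p | no q  = Data.Empty.⊥-elim (q (Relation.Binary.PropositionalEquality.sym p))
... | no p  | yes q = Data.Empty.⊥-elim (p (Relation.Binary.PropositionalEquality.sym q))
bookAdjV-sym (w _) (w _) = refl

bookAdjV-irrefl : ∀ {n} (a : BookV n) → bookAdjV a a ≡ false
bookAdjV-irrefl u₁ = refl
bookAdjV-irrefl u₂ = refl
bookAdjV-irrefl (v _) = refl
bookAdjV-irrefl (w _) = refl

Book : ℕ → Graph
Book n = record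
  { order  = 2 + (n + n)
  ; adj    = λ x y → bookAdjV (decode {n} x) (decode {n} y)
  ; sym    = λ x y → bookAdjV-sym (decode {n} x) (decode {n} y)
  ; irrefl = λ x → bookAdjV-irrefl (decode {n} x)
  }

-- Coefficients of the polynomial (2^n - 2) x^n + 2 x^(n+1).

bookPolyCoeff : ℕ → ℕ → ℕ
bookPolyCoeff n k with Data.Nat._≟_ k n | Data.Nat._≟_ k (suc n)
... | yes _ | _     = 2 ^ n ∸ 2
... | no _  | yes _ = 2
... | no _  | no _  = 0

module Submission where

-- Idea.  Call {vᵢ} the v-side and {wᵢ} the w-side of the pages.  In an
-- independent dominating set S of B_n every page contributes exactly one of
-- vᵢ, wᵢ (both are adjacent; if neither, vᵢ and wᵢ force both u₁ and u₂ into
-- S).  Hence S is determined by its v-side vs: the w-side is the complement,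
-- u₁ ∈ S iff vs = ∅ and u₂ ∈ S iff vs is everything; conversely each vs gives
-- such a set  embed vs, of size n + hubs vs with hubs vs ∈ {0, 1} the number
-- of u₁, u₂ present.  So counting sets of size k amounts to counting vs with
-- n + hubs vs = k: there are 2^n − 2 with no hub and 2 with one.

open import Defs hiding (sym)
open import Data.Bool using (Bool; true; false; not; T; if_then_else_)
open import Data.Bool.Properties using (¬-not; T?; T-≡) renaming (_≟_ to _≟𝔹_)
open import Data.Empty using (⊥; ⊥-elim)
open import Data.Fin using (Fin; zero; suc; splitAt; join; _↑ˡ_; _↑ʳ_) renaming (_≟_ to _≟ᶠ_)
open import Data.Fin.Properties using (¬∀⟶∃¬; splitAt-↑ˡ; splitAt-↑ʳ; join-splitAt)
open import Data.List using (List; []; _∷_; length; filter) renaming (_++_ to _++ₗ_; map to mapₗ)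
open import Data.Nat using (ℕ; zero; suc; _+_; _*_; _∸_; _^_; _≤_)
open import Data.Nat.Properties
  using (+-identityʳ; +-assoc; +-suc; *-identityˡ; *-identityʳ; m+n∸n≡m; 1+n≢n; +-commutativeSemigroup)
  renaming (_≟_ to _≟ℕ_)
open import Algebra.Properties.CommutativeSemigroup +-commutativeSemigroup using (interchange)
open import Data.Product using (_×_; _,_; ∃; proj₁; proj₂)
open import Data.Sum using (_⊎_; inj₁; inj₂)
open import Data.Unit using (tt)
open import Data.Vec using (Vec; []; _∷_; _++_; lookup; map; replicate; tabulate) renaming (splitAt to splitVec)
open import Data.Vec.Properties
  using (≡-dec; lookup-replicate; lookup-map; lookup-++ˡ; lookup-++ʳ; tabulate∘lookup; tabulate-cong)
open import Function using (_∘_)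
open import Function.Bundles using (Equivalence)
open import Relation.Binary.Definitions using (DecidableEquality)
open import Relation.Binary.PropositionalEquality
  using (_≡_; _≢_; refl; sym; trans; cong; cong₂; subst; subst₂; module ≡-Reasoning)
open import Relation.Nullary using (¬_; Dec; yes; no; does; contradiction)
open import Relation.Nullary.Decidable using (_×-dec_; toWitness; decidable-stable; dec-true; dec-false)

variable
  A B : Set

∑ : List A → (A → ℕ) → ℕ
∑ []       f = 0
∑ (x ∷ xs) f = f x + ∑ xs f

∑-cong : {f g : A → ℕ} (xs : List A) → (∀ x → f x ≡ g x) → ∑ xs f ≡ ∑ xs g
∑-cong []       f≗g = refl
∑-cong (x ∷ xs) f≗g = cong₂ _+_ (f≗g x) (∑-cong xs f≗g)

∑-++ : (xs ys : List A) (f : A → ℕ) → ∑ (xs ++ₗ ys) f ≡ ∑ xs f + ∑ ys f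
∑-++ []       ys f = refl
∑-++ (x ∷ xs) ys f = trans (cong (f x +_) (∑-++ xs ys f)) (sym (+-assoc (f x) _ _))

∑-map : (h : B → A) (xs : List B) (f : A → ℕ) → ∑ (mapₗ h xs) f ≡ ∑ xs (f ∘ h)
∑-map h []       f = refl
∑-map h (x ∷ xs) f = cong (f (h x) +_) (∑-map h xs f)

∑-zero : (xs : List A) → ∑ xs (λ _ → 0) ≡ 0
∑-zero []       = refl
∑-zero (x ∷ xs) = ∑-zero xs

∑-+ : (xs : List A) (f g : A → ℕ) → ∑ xs (λ x → f x + g x) ≡ ∑ xs f + ∑ xs g
∑-+ []       f g = refl
∑-+ (x ∷ xs) f g =
  trans (cong (f x + g x +_) (∑-+ xs f g)) (interchange (f x) (g x) (∑ xs f) (∑ xs g))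

∑-comm : (xs : List A) (ys : List B) (f : A → B → ℕ) →
         ∑ xs (λ x → ∑ ys (f x)) ≡ ∑ ys (λ y → ∑ xs (λ x → f x y))
∑-comm []       ys f = sym (∑-zero ys)
∑-comm (x ∷ xs) ys f =
  trans (cong (∑ ys (f x) +_) (∑-comm xs ys f)) (sym (∑-+ ys (f x) (λ y → ∑ xs (λ x′ → f x′ y))))

⟦_⟧ : {P : Set} → Dec P → ℕ
⟦ P? ⟧ = if does P? then 1 else 0

⟦yes⟧ : {P : Set} (P? : Dec P) → P → ⟦ P? ⟧ ≡ 1
⟦yes⟧ (yes _) p = refl
⟦yes⟧ (no ¬p) p = contradiction p ¬p

⟦no⟧ : {P : Set} (P? : Dec P) → ¬ P → ⟦ P? ⟧ ≡ 0
⟦no⟧ (yes p) ¬p = contradiction p ¬p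
⟦no⟧ (no _)  ¬p = refl

⟦×⟧ : {P Q : Set} (P? : Dec P) (Q? : Dec Q) → ⟦ P? ×-dec Q? ⟧ ≡ ⟦ P? ⟧ * ⟦ Q? ⟧
⟦×⟧ (yes _) Q? = sym (*-identityˡ ⟦ Q? ⟧)
⟦×⟧ (no _)  Q? = refl

length-filter : {P : A → Set} (P? : ∀ x → Dec (P x)) (xs : List A) →
                length (filter P? xs) ≡ ∑ xs (λ x → ⟦ P? x ⟧)
length-filter P? []       = refl
length-filter P? (x ∷ xs) with does (P? x)
... | true  = cong suc (length-filter P? xs)
... | false = length-filter P? xs

does-sound : {P : Set} (P? : Dec P) → T (does P?) → P
does-sound (yes p) _ = p

does-complete : {P : Set} (P? : Dec P) → P → T (does P?)
does-complete (yes _) _ = tt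
does-complete (no ¬p) p = ¬p p

reflects⇒does : {P : Set} {x : Bool} (P? : Dec P) → (T x → P) → (P → T x) → x ≡ does P?
reflects⇒does {x = true}  P? x⇒P P⇒x = sym (dec-true P? (x⇒P tt))
reflects⇒does {x = false} P? x⇒P P⇒x = sym (dec-false P? P⇒x)

T-stable : {x : Bool} → ¬ ¬ T x → T x
T-stable {x} = decidable-stable (T? x)

≡true⇒T : {x : Bool} → x ≡ true → T x
≡true⇒T = Equivalence.from T-≡

¬T⇒≡false : {x : Bool} → ¬ T x → x ≡ false
¬T⇒≡false ¬x = ¬-not (¬x ∘ ≡true⇒T)

_≟ᵛ_ : ∀ {m} → DecidableEquality (VSet m)
_≟ᵛ_ = ≡-dec _≟𝔹_

∑-allVSets-suc : ∀ m (f : VSet (suc m) → ℕ) →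
  ∑ (allVSets (suc m)) f ≡ ∑ (allVSets m) (f ∘ (true ∷_)) + ∑ (allVSets m) (f ∘ (false ∷_))
∑-allVSets-suc m f =
  trans (∑-++ (mapₗ (true ∷_) (allVSets m)) (mapₗ (false ∷_) (allVSets m)) f)
        (cong₂ _+_ (∑-map (true ∷_) (allVSets m) f) (∑-map (false ∷_) (allVSets m) f))

∑-allVSets-one : ∀ m → ∑ (allVSets m) (λ _ → 1) ≡ 2 ^ m
∑-allVSets-one zero    = refl
∑-allVSets-one (suc m) =
  trans (∑-allVSets-suc m (λ _ → 1))
        (cong₂ _+_ (∑-allVSets-one m) (trans (∑-allVSets-one m) (sym (+-identityʳ (2 ^ m)))))

-- Every subset occurs exactly once in allVSets m, so summing against the
-- indicator of S ≡ t picks out the value at t.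
∑-δ : ∀ {m} (t : VSet m) (g : VSet m → ℕ) → ∑ (allVSets m) (λ S → ⟦ S ≟ᵛ t ⟧ * g S) ≡ g t
∑-δ           []          g = trans (+-identityʳ _) (*-identityˡ (g []))
∑-δ {suc m} (true  ∷ t) g =
  trans (∑-allVSets-suc m (λ S → ⟦ S ≟ᵛ (true ∷ t) ⟧ * g S))
        (trans (cong₂ _+_ (∑-δ t (g ∘ (true ∷_))) (∑-zero (allVSets m))) (+-identityʳ _))
∑-δ {suc m} (false ∷ t) g =
  trans (∑-allVSets-suc m (λ S → ⟦ S ≟ᵛ (false ∷ t) ⟧ * g S))
        (cong₂ _+_ (∑-zero (allVSets m)) (∑-δ t (g ∘ (false ∷_))))

-- Counting the image of a map with a left inverse.
module Image {p m} {P : VSet m → Set} (P? : ∀ S → Dec (P S))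
             (e : VSet p → VSet m) (r : VSet m → VSet p) (r∘e : ∀ x → r (e x) ≡ x)
             (P-image : ∀ x → P (e x)) (P⇒image : ∀ S → P S → S ≡ e (r S)) where

  -- S = e x  iff  x = r S and P S.
  indicator-split : ∀ S x (g : ℕ) → ⟦ S ≟ᵛ e x ⟧ * g ≡ ⟦ x ≟ᵛ r S ⟧ * (⟦ P? S ⟧ * g)
  indicator-split S x g with x ≟ᵛ r S | P? S
  ... | yes refl | yes PS =
    trans (cong (_* g) (⟦yes⟧ (S ≟ᵛ e (r S)) (P⇒image S PS))) (sym (*-identityˡ (1 * g)))
  ... | yes refl | no ¬PS =
    cong (_* g) (⟦no⟧ (S ≟ᵛ e (r S)) λ S≡erS → ¬PS (subst P (sym S≡erS) (P-image (r S))))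
  ... | no x≢rS  | _      =
    cong (_* g) (⟦no⟧ (S ≟ᵛ e x) λ S≡ex → x≢rS (trans (sym (r∘e x)) (cong r (sym S≡ex))))

  ∑-image : (g : VSet m → ℕ) → ∑ (allVSets m) (λ S → ⟦ P? S ⟧ * g S) ≡ ∑ (allVSets p) (g ∘ e)
  ∑-image g = begin
    ∑ (allVSets m) (λ S → ⟦ P? S ⟧ * g S)
      ≡⟨ ∑-cong (allVSets m) (λ S → sym (∑-δ (r S) (λ _ → ⟦ P? S ⟧ * g S))) ⟩
    ∑ (allVSets m) (λ S → ∑ (allVSets p) (λ x → ⟦ x ≟ᵛ r S ⟧ * (⟦ P? S ⟧ * g S)))
      ≡⟨ ∑-cong (allVSets m) (λ S → ∑-cong (allVSets p) (λ x → sym (indicator-split S x (g S)))) ⟩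
    ∑ (allVSets m) (λ S → ∑ (allVSets p) (λ x → ⟦ S ≟ᵛ e x ⟧ * g S))
      ≡⟨ ∑-comm (allVSets m) (allVSets p) (λ S x → ⟦ S ≟ᵛ e x ⟧ * g S) ⟩
    ∑ (allVSets p) (λ x → ∑ (allVSets m) (λ S → ⟦ S ≟ᵛ e x ⟧ * g S))
      ≡⟨ ∑-cong (allVSets p) (λ x → ∑-δ (e x) g) ⟩
    ∑ (allVSets p) (g ∘ e) ∎
    where open ≡-Reasoning

lookup-ext : ∀ {m} {xs ys : Vec A m} → (∀ i → lookup xs i ≡ lookup ys i) → xs ≡ ys
lookup-ext {xs = xs} {ys} xs≗ys =
  trans (sym (tabulate∘lookup xs)) (trans (tabulate-cong xs≗ys) (tabulate∘lookup ys))

zeros ones : ∀ {n} → Vec Bool n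
zeros {n} = replicate n false
ones  {n} = replicate n true

lookup-const : ∀ {n} {vs : Vec Bool n} {b : Bool} → vs ≡ replicate n b → ∀ i → lookup vs i ≡ b
lookup-const {b = b} refl i = lookup-replicate i b

≢-replicate : ∀ {m} (xs : Vec Bool m) (b : Bool) → xs ≢ replicate m b → ∃ λ i → lookup xs i ≡ not b
≢-replicate {m} xs b xs≢bs =
  let i , xsᵢ≢b = ¬∀⟶∃¬ m (λ i → lookup xs i ≡ b) (λ i → lookup xs i ≟𝔹 b) not-constant
  in i , ¬-not xsᵢ≢b
  where
  not-constant : ¬ (∀ i → lookup xs i ≡ b)
  not-constant xs≗b = xs≢bs (lookup-ext λ i → trans (xs≗b i) (sym (lookup-replicate i b)))

complement-in : ∀ {n} (vs : Vec Bool n) i → ¬ T (lookup vs i) → T (lookup (map not vs) i)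
complement-in vs i vᵢ∉ rewrite lookup-map i not vs | ¬T⇒≡false vᵢ∉ = tt

complement-out : ∀ {n} (vs : Vec Bool n) i → T (lookup (map not vs) i) → ¬ T (lookup vs i)
complement-out vs i notvᵢ∈ rewrite lookup-map i not vs with lookup vs i
... | true  = λ _ → notvᵢ∈
... | false = λ vᵢ∈ → vᵢ∈

card-∷ : ∀ {m} {P : Set} (P? : Dec P) (xs : VSet m) → card (does P? ∷ xs) ≡ ⟦ P? ⟧ + card xs
card-∷ (yes _) xs = refl
card-∷ (no _)  xs = refl

card-++ : ∀ {p q} (xs : VSet p) (ys : VSet q) → card (xs ++ ys) ≡ card xs + card ys
card-++ []           ys = refl
card-++ (true  ∷ xs) ys = cong suc (card-++ xs ys)
card-++ (false ∷ xs) ys = card-++ xs ys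

card-complement : ∀ {m} (xs : VSet m) → card xs + card (map not xs) ≡ m
card-complement []           = refl
card-complement (true  ∷ xs) = cong suc (card-complement xs)
card-complement (false ∷ xs) = trans (+-suc (card xs) _) (cong suc (card-complement xs))

encode : ∀ {n} → BookV n → Fin (2 + (n + n))
encode     u₁    = zero
encode     u₂    = suc zero
encode {n} (v i) = suc (suc (i ↑ˡ n))
encode {n} (w i) = suc (suc (n ↑ʳ i))

decode-encode : ∀ {n} (p : BookV n) → decode (encode p) ≡ p
decode-encode     u₁    = refl
decode-encode     u₂    = refl
decode-encode {n} (v i) rewrite splitAt-↑ˡ n i n = refl
decode-encode {n} (w i) rewrite splitAt-↑ʳ n n i = refl

encode-decode : ∀ {n} (x : Fin (2 + (n + n))) → encode (decode {n} x) ≡ x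
encode-decode     zero          = refl
encode-decode     (suc zero)    = refl
encode-decode {n} (suc (suc j)) with splitAt n j in split-j
... | inj₁ i = cong (λ k → suc (suc k)) (trans (cong (join n n) (sym split-j)) (join-splitAt n n j))
... | inj₂ i = cong (λ k → suc (suc k)) (trans (cong (join n n) (sym split-j)) (join-splitAt n n j))

data Edge {n} : BookV n → BookV n → Set where
  spine : Edge u₁ u₂
  u₁v   : ∀ i → Edge u₁ (v i)
  u₂w   : ∀ i → Edge u₂ (w i)
  vw    : ∀ i → Edge (v i) (w i)

Adjacent : ∀ {n} → BookV n → BookV n → Set
Adjacent p q = Edge p q ⊎ Edge q p

edge-adjacent : ∀ {n} {p q : BookV n} → Edge p q → T (bookAdjV p q)
edge-adjacent spine   = tt
edge-adjacent (u₁v i) = tt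
edge-adjacent (u₂w i) = tt
edge-adjacent (vw i) with i ≟ᶠ i
... | yes _   = tt
... | no i≢i = i≢i refl

adjacent-sound : ∀ {n} {p q : BookV n} → Adjacent p q → T (bookAdjV p q)
adjacent-sound                 (inj₁ e) = edge-adjacent e
adjacent-sound {p = p} {q = q} (inj₂ e) = subst T (bookAdjV-sym q p) (edge-adjacent e)

adjacent-complete : ∀ {n} (p q : BookV n) → T (bookAdjV p q) → Adjacent p q
adjacent-complete u₁    u₂    _ = inj₁ spine
adjacent-complete u₂    u₁    _ = inj₂ spine
adjacent-complete u₁    (v i) _ = inj₁ (u₁v i)
adjacent-complete (v i) u₁    _ = inj₂ (u₁v i)
adjacent-complete u₂    (w i) _ = inj₁ (u₂w i)
adjacent-complete (w i) u₂    _ = inj₂ (u₂w i)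
adjacent-complete (v i) (w j) adj with toWitness adj
... | refl = inj₁ (vw i)
adjacent-complete (w i) (v j) adj with toWitness adj
... | refl = inj₂ (vw i)

IndependentB : ∀ {n} → (BookV n → Bool) → Set
IndependentB s = ∀ {p q} → Edge p q → T (s p) → T (s q) → ⊥

DominatingB : ∀ {n} → (BookV n → Bool) → Set
DominatingB {n} s = ∀ p → ¬ T (s p) → ∃ λ (q : BookV n) → T (s q) × Adjacent p q

IndependentDominatingB : ∀ {n} → (BookV n → Bool) → Set
IndependentDominatingB s = IndependentB s × DominatingB s

module Transfer {n} (S : VSet (2 + (n + n))) (s : BookV n → Bool)
                (S∘encode : ∀ p → lookup S (encode p) ≡ s p) where

  S-decode : ∀ x → lookup S x ≡ s (decode {n} x)
  S-decode x = trans (cong (lookup S) (sym (encode-decode {n} x))) (S∘encode (decode {n} x))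

  adj-encode : ∀ {p q} → Adjacent p q → T (adj (Book n) (encode p) (encode q))
  adj-encode {p} {q} a = subst₂ (λ (p′ q′ : BookV n) → T (bookAdjV p′ q′))
                                (sym (decode-encode p)) (sym (decode-encode q)) (adjacent-sound a)

  independent⇒ : Independent (Book n) S → IndependentB s
  independent⇒ I {p} {q} e sp sq =
    I (encode p) (encode q) (subst T (sym (S∘encode p)) sp) (subst T (sym (S∘encode q)) sq)
      (adj-encode (inj₁ e))

  independent⇐ : IndependentB s → Independent (Book n) S
  independent⇐ I x y Sx Sy a with adjacent-complete (decode {n} x) (decode {n} y) a
  ... | inj₁ e = I e (subst T (S-decode x) Sx) (subst T (S-decode y) Sy)
  ... | inj₂ e = I e (subst T (S-decode y) Sy) (subst T (S-decode x) Sx)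

  dominating⇒ : Dominating (Book n) S → DominatingB s
  dominating⇒ D p sp∉ with D (encode p) (sp∉ ∘ subst T (S∘encode p))
  ... | y , Sy , a = decode y , subst T (S-decode y) Sy ,
    adjacent-complete p (decode {n} y) (subst (λ p′ → T (bookAdjV p′ (decode {n} y))) (decode-encode p) a)

  dominating⇐ : DominatingB s → Dominating (Book n) S
  dominating⇐ D x Sx∉ with D (decode {n} x) (Sx∉ ∘ subst T (sym (S-decode x)))
  ... | q , sq , a = encode q , subst T (sym (S∘encode q)) sq ,
    subst (λ x′ → T (adj (Book n) x′ (encode {n} q))) (encode-decode {n} x) (adj-encode a)

members : ∀ {n} → Bool → Bool → Vec Bool n → Vec Bool n → BookV n → Bool
members a b vs ws u₁    = a
members a b vs ws u₂    = b
members a b vs ws (v i) = lookup vs i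
members a b vs ws (w i) = lookup ws i

lookup-encode : ∀ {n} a b (vs ws : Vec Bool n) p →
                lookup (a ∷ b ∷ (vs ++ ws)) (encode p) ≡ members a b vs ws p
lookup-encode a b vs ws u₁    = refl
lookup-encode a b vs ws u₂    = refl
lookup-encode a b vs ws (v i) = lookup-++ˡ vs ws i
lookup-encode a b vs ws (w i) = lookup-++ʳ vs ws i

module _ {n} (a b : Bool) (vs ws : Vec Bool n) where
  open Transfer (a ∷ b ∷ (vs ++ ws)) (members a b vs ws) (lookup-encode a b vs ws)

  ids⇒idsB : IndependentDominating (Book n) (a ∷ b ∷ (vs ++ ws)) →
             IndependentDominatingB (members a b vs ws)
  ids⇒idsB (I , D) = independent⇒ I , dominating⇒ D

  idsB⇒ids : IndependentDominatingB (members a b vs ws) →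
             IndependentDominating (Book n) (a ∷ b ∷ (vs ++ ws))
  idsB⇒ids (I , D) = independent⇐ I , dominating⇐ D

embed : ∀ {n} → Vec Bool n → VSet (2 + (n + n))
embed vs = does (vs ≟ᵛ zeros) ∷ does (vs ≟ᵛ ones) ∷ (vs ++ map not vs)

-- The v-side of a vertex set; a left inverse of embed.
pages : ∀ {n} → VSet (2 + (n + n)) → Vec Bool n
pages S = tabulate (λ i → lookup S (encode (v i)))

pages-decomposed : ∀ {n} a b (vs ws : Vec Bool n) → pages (a ∷ b ∷ (vs ++ ws)) ≡ vs
pages-decomposed a b vs ws = trans (tabulate-cong (lookup-encode a b vs ws ∘ v)) (tabulate∘lookup vs)

hubs : ∀ {n} → Vec Bool n → ℕ
hubs vs = ⟦ vs ≟ᵛ zeros ⟧ + ⟦ vs ≟ᵛ ones ⟧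

card-embed : ∀ {n} (vs : Vec Bool n) → card (embed vs) ≡ hubs vs + n
card-embed {n} vs = begin
  card (embed vs)
    ≡⟨ card-∷ (vs ≟ᵛ zeros) _ ⟩
  ⟦ vs ≟ᵛ zeros ⟧ + card (does (vs ≟ᵛ ones) ∷ (vs ++ map not vs))
    ≡⟨ cong (⟦ vs ≟ᵛ zeros ⟧ +_) (card-∷ (vs ≟ᵛ ones) _) ⟩
  ⟦ vs ≟ᵛ zeros ⟧ + (⟦ vs ≟ᵛ ones ⟧ + card (vs ++ map not vs))
    ≡⟨ sym (+-assoc ⟦ vs ≟ᵛ zeros ⟧ _ _) ⟩
  hubs vs + card (vs ++ map not vs)
    ≡⟨ cong (hubs vs +_) (trans (card-++ vs (map not vs)) (card-complement vs)) ⟩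
  hubs vs + n ∎
  where open ≡-Reasoning

-- The independent dominating sets of B_n for n ≥ 1 (a page page₀ exists).
module Characterisation {n} (page₀ : Fin n) where

  zeros≢ones : zeros {n} ≢ ones
  zeros≢ones eq with trans (sym (lookup-const refl page₀)) (lookup-const eq page₀)
  ... | ()

  embedded : Vec Bool n → BookV n → Bool
  embedded vs = members (does (vs ≟ᵛ zeros)) (does (vs ≟ᵛ ones)) vs (map not vs)

  embedded-independent : ∀ vs → IndependentB (embedded vs)
  embedded-independent vs spine u₁∈ u₂∈ =
    zeros≢ones (trans (sym (does-sound (vs ≟ᵛ zeros) u₁∈)) (does-sound (vs ≟ᵛ ones) u₂∈))
  embedded-independent vs (u₁v i) u₁∈ vᵢ∈ =
    subst T (lookup-const (does-sound (vs ≟ᵛ zeros) u₁∈) i) vᵢ∈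
  embedded-independent vs (u₂w i) u₂∈ wᵢ∈ =
    complement-out vs i wᵢ∈ (≡true⇒T (lookup-const (does-sound (vs ≟ᵛ ones) u₂∈) i))
  embedded-independent vs (vw i) vᵢ∈ wᵢ∈ = complement-out vs i wᵢ∈ vᵢ∈

  embedded-dominating : ∀ vs → DominatingB (embedded vs)
  embedded-dominating vs u₁ u₁∉ with ≢-replicate vs false (u₁∉ ∘ does-complete (vs ≟ᵛ zeros))
  ... | i , vᵢ≡true = v i , ≡true⇒T vᵢ≡true , inj₁ (u₁v i)
  embedded-dominating vs u₂ u₂∉ with ≢-replicate vs true (u₂∉ ∘ does-complete (vs ≟ᵛ ones))
  ... | i , vᵢ≡false = w i , complement-in vs i (subst T vᵢ≡false) , inj₁ (u₂w i)
  embedded-dominating vs (v i) vᵢ∉ = w i , complement-in vs i vᵢ∉ , inj₁ (vw i)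
  embedded-dominating vs (w i) wᵢ∉ = v i , T-stable (wᵢ∉ ∘ complement-in vs i) , inj₂ (vw i)

  embed-ids : ∀ vs → IndependentDominating (Book n) (embed vs)
  embed-ids vs = idsB⇒ids _ _ vs (map not vs) (embedded-independent vs , embedded-dominating vs)

  module Forced {a b : Bool} {vs ws : Vec Bool n} (I : IndependentB (members a b vs ws))
                (D : DominatingB (members a b vs ws)) where

    dominator-u₁ : ¬ T a → T b ⊎ ∃ λ i → T (lookup vs i)
    dominator-u₁ u₁∉ with D u₁ u₁∉
    ... | _ , u₂∈ , inj₁ spine   = inj₁ u₂∈
    ... | _ , vᵢ∈ , inj₁ (u₁v i) = inj₂ (i , vᵢ∈)

    dominator-u₂ : ¬ T b → T a ⊎ ∃ λ i → T (lookup ws i)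
    dominator-u₂ u₂∉ with D u₂ u₂∉
    ... | _ , u₁∈ , inj₂ spine   = inj₁ u₁∈
    ... | _ , wᵢ∈ , inj₁ (u₂w i) = inj₂ (i , wᵢ∈)

    dominator-v : ∀ i → ¬ T (lookup vs i) → T a ⊎ T (lookup ws i)
    dominator-v i vᵢ∉ with D (v i) vᵢ∉
    ... | _ , u₁∈ , inj₂ (u₁v _) = inj₁ u₁∈
    ... | _ , wᵢ∈ , inj₁ (vw _)  = inj₂ wᵢ∈

    dominator-w : ∀ i → ¬ T (lookup ws i) → T b ⊎ T (lookup vs i)
    dominator-w i wᵢ∉ with D (w i) wᵢ∉
    ... | _ , u₂∈ , inj₂ (u₂w _) = inj₁ u₂∈
    ... | _ , vᵢ∈ , inj₂ (vw _)  = inj₂ vᵢ∈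

    -- Each page contributes exactly one of vᵢ, wᵢ: both would be adjacent,
    -- neither would force both u₁ and u₂ into the set.
    complementary : ws ≡ map not vs
    complementary = lookup-ext λ i → trans (exactly-one i) (sym (lookup-map i not vs))
      where
      exactly-one : ∀ i → lookup ws i ≡ not (lookup vs i)
      exactly-one i with lookup vs i | lookup ws i | I (vw i) | dominator-v i | dominator-w i
      ... | true  | true  | clash | _  | _  = ⊥-elim (clash tt tt)
      ... | true  | false | _     | _  | _  = refl
      ... | false | true  | _     | _  | _  = refl
      ... | false | false | _     | dv | dw with dv (λ ()) | dw (λ ())
      ...   | inj₁ u₁∈ | inj₁ u₂∈ = ⊥-elim (I spine u₁∈ u₂∈)

    -- u₁ is in iff no vᵢ is (if vs = ∅, u₁ could only be dominated by u₂,
    -- which is adjacent to the wᵢ of page₀).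
    u₁-forced : a ≡ does (vs ≟ᵛ zeros)
    u₁-forced = reflects⇒does (vs ≟ᵛ zeros) u₁∈⇒zeros zeros⇒u₁∈
      where
      u₁∈⇒zeros : T a → vs ≡ zeros
      u₁∈⇒zeros u₁∈ = lookup-ext λ i →
        trans (¬T⇒≡false (I (u₁v i) u₁∈)) (sym (lookup-replicate i false))
      zeros⇒u₁∈ : vs ≡ zeros → T a
      zeros⇒u₁∈ vs≡zeros = T-stable λ u₁∉ → no-dominator (dominator-u₁ u₁∉)
        where
        v-absent : ∀ i → ¬ T (lookup vs i)
        v-absent i = subst T (lookup-const vs≡zeros i)
        no-dominator : T b ⊎ ∃ (λ i → T (lookup vs i)) → ⊥
        no-dominator (inj₁ u₂∈) =
          I (u₂w page₀) u₂∈ (subst (λ xs → T (lookup xs page₀)) (sym complementary)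
                                   (complement-in vs page₀ (v-absent page₀)))
        no-dominator (inj₂ (i , vᵢ∈)) = v-absent i vᵢ∈

    u₂-forced : b ≡ does (vs ≟ᵛ ones)
    u₂-forced = reflects⇒does (vs ≟ᵛ ones) u₂∈⇒ones ones⇒u₂∈
      where
      w-absent⇒v-present : ∀ i → ¬ T (lookup ws i) → T (lookup vs i)
      w-absent⇒v-present i wᵢ∉ =
        T-stable (wᵢ∉ ∘ subst (λ xs → T (lookup xs i)) (sym complementary) ∘ complement-in vs i)
      u₂∈⇒ones : T b → vs ≡ ones
      u₂∈⇒ones u₂∈ = lookup-ext λ i →
        trans (Equivalence.to T-≡ (w-absent⇒v-present i (I (u₂w i) u₂∈))) (sym (lookup-replicate i true))
      ones⇒u₂∈ : vs ≡ ones → T b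
      ones⇒u₂∈ vs≡ones = T-stable λ u₂∉ → no-dominator (dominator-u₂ u₂∉)
        where
        v-present : ∀ i → T (lookup vs i)
        v-present i = ≡true⇒T (lookup-const vs≡ones i)
        no-dominator : T a ⊎ ∃ (λ i → T (lookup ws i)) → ⊥
        no-dominator (inj₁ u₁∈) = I (u₁v page₀) u₁∈ (v-present page₀)
        no-dominator (inj₂ (i , wᵢ∈)) =
          complement-out vs i (subst (λ xs → T (lookup xs i)) complementary wᵢ∈) (v-present i)

  ids⇒embed : ∀ S → IndependentDominating (Book n) S → S ≡ embed (pages {n} S)
  ids⇒embed (a ∷ b ∷ rest) ids with splitVec n rest
  ... | vs , ws , refl rewrite pages-decomposed a b vs ws =
    cong₂ _∷_ u₁-forced (cong₂ _∷_ u₂-forced (cong (vs ++_) complementary))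
    where open Forced (proj₁ (ids⇒idsB a b vs ws ids)) (proj₂ (ids⇒idsB a b vs ws ids))

  -- A v-side cannot be both empty and full, so at most one hub is present.
  hubs-0or1 : ∀ vs → hubs vs ≡ 0 ⊎ hubs vs ≡ 1
  hubs-0or1 vs with vs ≟ᵛ zeros | vs ≟ᵛ ones
  ... | yes refl | yes zeros≡ones = ⊥-elim (zeros≢ones zeros≡ones)
  ... | yes _    | no _           = inj₂ refl
  ... | no _     | yes _          = inj₂ refl
  ... | no _     | no _           = inj₁ refl

  ∑-hubs : ∑ (allVSets n) hubs ≡ 2
  ∑-hubs = trans (∑-+ (allVSets n) (λ vs → ⟦ vs ≟ᵛ zeros ⟧) (λ vs → ⟦ vs ≟ᵛ ones ⟧))
                 (cong₂ _+_ (∑-indicator zeros) (∑-indicator ones))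
    where
    ∑-indicator : ∀ t → ∑ (allVSets n) (λ vs → ⟦ vs ≟ᵛ t ⟧) ≡ 1
    ∑-indicator t = trans (∑-cong (allVSets n) (λ vs → sym (*-identityʳ ⟦ vs ≟ᵛ t ⟧))) (∑-δ t (λ _ → 1))

  -- Since hubs vs + n is n or n + 1, the sets of size n are those without a
  -- hub (2^n − 2 of them) and the sets of size n + 1 those with one (2).
  ∑-size : ∀ k → ∑ (allVSets n) (λ vs → ⟦ hubs vs + n ≟ℕ k ⟧) ≡ bookPolyCoeff n k
  ∑-size k with k ≟ℕ n | k ≟ℕ suc n
  ... | yes refl | _ = begin
    ∑ (allVSets n) size-n                              ≡⟨ m+n∸n≡m _ 2 ⟨
    ∑ (allVSets n) size-n + 2 ∸ 2                      ≡⟨ cong (λ h → ∑ (allVSets n) size-n + h ∸ 2) ∑-hubs ⟨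
    ∑ (allVSets n) size-n + ∑ (allVSets n) hubs ∸ 2    ≡⟨ cong (_∸ 2) (∑-+ (allVSets n) size-n hubs) ⟨
    ∑ (allVSets n) (λ vs → size-n vs + hubs vs) ∸ 2    ≡⟨ cong (_∸ 2) (∑-cong (allVSets n) (one-of ∘ hubs-0or1)) ⟩
    ∑ (allVSets n) (λ _ → 1) ∸ 2                       ≡⟨ cong (_∸ 2) (∑-allVSets-one n) ⟩
    2 ^ n ∸ 2                                          ∎
    where
    open ≡-Reasoning
    size-n : Vec Bool n → ℕ
    size-n vs = ⟦ hubs vs + n ≟ℕ n ⟧
    one-of : ∀ {h} → h ≡ 0 ⊎ h ≡ 1 → ⟦ h + n ≟ℕ n ⟧ + h ≡ 1
    one-of (inj₁ refl) = cong (_+ 0) (⟦yes⟧ (n ≟ℕ n) refl)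
    one-of (inj₂ refl) = cong (_+ 1) (⟦no⟧ (suc n ≟ℕ n) 1+n≢n)
  ... | no _ | yes refl = trans (∑-cong (allVSets n) (size-suc-n ∘ hubs-0or1)) ∑-hubs
    where
    size-suc-n : ∀ {h} → h ≡ 0 ⊎ h ≡ 1 → ⟦ h + n ≟ℕ suc n ⟧ ≡ h
    size-suc-n (inj₁ refl) = ⟦no⟧ (n ≟ℕ suc n) (1+n≢n ∘ sym)
    size-suc-n (inj₂ refl) = ⟦yes⟧ (suc n ≟ℕ suc n) refl
  ... | no k≢n | no k≢1+n = trans (∑-cong (allVSets n) (size-other ∘ hubs-0or1)) (∑-zero (allVSets n))
    where
    size-other : ∀ {h} → h ≡ 0 ⊎ h ≡ 1 → ⟦ h + n ≟ℕ k ⟧ ≡ 0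
    size-other (inj₁ refl) = ⟦no⟧ (n ≟ℕ k) (k≢n ∘ sym)
    size-other (inj₂ refl) = ⟦no⟧ (suc n ≟ℕ k) (k≢1+n ∘ sym)

-- The independent dominating sets of size k are the sets embed vs of size k;
-- B_n has a page since n ≥ 2.
mainTheorem15 : (n : ℕ) → 2 ≤ n → (k : ℕ) → dᵢ (Book n) k ≡ bookPolyCoeff n k
mainTheorem15 zero    () _
mainTheorem15 (suc m) _  k = begin
  dᵢ (Book n) k
    ≡⟨ length-filter (λ S → indDom? (Book n) S ×-dec hasSize? k S) (allVSets _) ⟩
  ∑ (allVSets _) (λ S → ⟦ indDom? (Book n) S ×-dec (card S ≟ℕ k) ⟧)
    ≡⟨ ∑-cong (allVSets _) (λ S → ⟦×⟧ (indDom? (Book n) S) (card S ≟ℕ k)) ⟩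
  ∑ (allVSets _) (λ S → ⟦ indDom? (Book n) S ⟧ * ⟦ card S ≟ℕ k ⟧)
    ≡⟨ ∑-image (λ S → ⟦ card S ≟ℕ k ⟧) ⟩
  ∑ (allVSets n) (λ vs → ⟦ card (embed vs) ≟ℕ k ⟧)
    ≡⟨ ∑-cong (allVSets n) (λ vs → cong (λ c → ⟦ c ≟ℕ k ⟧) (card-embed vs)) ⟩
  ∑ (allVSets n) (λ vs → ⟦ hubs vs + n ≟ℕ k ⟧)
    ≡⟨ ∑-size k ⟩
  bookPolyCoeff n k ∎
  where
  n = suc m
  open ≡-Reasoning
  open Characterisation {n} zero
  open Image (indDom? (Book n)) embed pages
             (λ vs → pages-decomposed (does (vs ≟ᵛ zeros)) (does (vs ≟ᵛ ones)) vs (map not vs))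
             embed-ids ids⇒embed
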